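{- Let $\tilde\alpha,\tilde\beta\in\mathbb{C}$ and let $(\tau_n)_{n\in\mathbb{Z}}$ be nonzero complex numbers satisfying the Somos 5 recurrence $\tau_{n+3}\tau_{n-2}=\tilde\alpha\,\tau_{n+2}\tau_{n-1}+\tilde\beta\,\tau_{n+1}\tau_n$ for all $n$. Put $h_n=\tau_{n+2}\tau_{n-1}/(\tau_{n+1}\tau_n)$ and let $\tilde J=h_{n-1}+h_n+\tilde\alpha\big(\frac1{h_{n-1}}+\frac1{h_n}\big)+\frac{\tilde\beta}{h_{n-1}h_n}$ (which is independent of $n$). Then both subsequences $\tau^*_n=\tau_{2n}$ and $\tau^*_n=\tau_{2n+1}$ satisfy the Somos 4 recurrence $$\tau^*_{n+2}\tau^*_{n-2}=\alpha^*\,\tau^*_{n+1}\tau^*_{n-1}+\beta^*(\tau^*_n)^2\quad\text{for all } n,$$ where $\alpha^*=\tilde\beta^2$ and $\beta^*=\tilde\alpha\,(2\tilde\beta^2+\tilde\alpha\tilde\beta\tilde J+\tilde\alpha^3)$. -}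

module Defs where

open import Level using (Level; _⊔_) renaming (suc to lsuc)
open import Algebra.Bundles using (CommutativeRing)
open import Relation.Nullary using (¬_)
open import Data.Nat using (ℕ; zero; suc)
open import Data.Integer as ℤ using (ℤ; +_)

-- The inverse is given as a total function `inv`;
-- its value at 0 is unconstrained and is never used below.
record Field (c ℓ : Level) : Set (lsuc (c ⊔ ℓ)) where
  field
    commutativeRing : CommutativeRing c ℓ
  open CommutativeRing commutativeRing public
  field
    0≉1 : ¬ (0# ≈ 1#)
    inv : Carrier → Carrier
    inverseʳ : ∀ x → ¬ (x ≈ 0#) → x * inv x ≈ 1#

module _ {c ℓ : Level} (F : Field c ℓ) where
  open Field F

  fromℕ : ℕ → Carrier
  fromℕ zero    = 0#
  fromℕ (suc n) = 1# + fromℕ n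

  CharZero : Set ℓ
  CharZero = ∀ n → ¬ (fromℕ (suc n) ≈ 0#)

  Somos5 : Carrier → Carrier → (ℤ → Carrier) → Set ℓ
  Somos5 α β τ = ∀ n →
    τ (n ℤ.+ + 3) * τ (n ℤ.- + 2)
      ≈ α * τ (n ℤ.+ + 2) * τ (n ℤ.- + 1) + β * τ (n ℤ.+ + 1) * τ n

  Somos4 : Carrier → Carrier → (ℤ → Carrier) → Set ℓ
  Somos4 a b σ = ∀ n →
    σ (n ℤ.+ + 2) * σ (n ℤ.- + 2)
      ≈ a * σ (n ℤ.+ + 1) * σ (n ℤ.- + 1) + b * (σ n * σ n)

  hSeq : (ℤ → Carrier) → ℤ → Carrier
  hSeq τ n = τ (n ℤ.+ + 2) * τ (n ℤ.- + 1) * inv (τ (n ℤ.+ + 1) * τ n)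

  Jat : Carrier → Carrier → (ℤ → Carrier) → ℤ → Carrier
  Jat α β τ n =
    h (n ℤ.- + 1) + h n + α * (inv (h (n ℤ.- + 1)) + inv (h n))
      + β * inv (h (n ℤ.- + 1) * h n)
    where h = hSeq τ

evenSub : ∀ {a} {A : Set a} → (ℤ → A) → ℤ → A
evenSub τ n = τ (+ 2 ℤ.* n)

oddSub : ∀ {a} {A : Set a} → (ℤ → A) → ℤ → A
oddSub τ n = τ (+ 2 ℤ.* n ℤ.+ + 1)

{-# OPTIONS --safe #-}
module Submission where

-- Clearing denominators, J̃ computed at n equals N_n / D_n, where D_n = τ_{n-2} ⋯ τ_{n+2} and
-- N_n is a polynomial in the same five terms. A single Somos 5 relation gives
-- N_n D_{n+1} = N_{n+1} D_n, so J̃ does not depend on n. Multiplied by D_m, the relation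
--   τ_{m+4} τ_{m-4} = β̃² τ_{m+2} τ_{m-2} + β* τ_m²
-- follows from D_m J̃ = N_m and the four Somos 5 relations centred at m-2, …, m+1 by an explicit
-- polynomial certificate; dividing by D_m ≠ 0 gives Somos 4 along every step-two subsequence.

open import Defs
open import Level using (Level)
open import Algebra.Bundles using (CommutativeRing)
open import Data.Integer as ℤ using (ℤ; +_; -[1+_])
import Data.Integer.Properties as ℤ
open import Data.Integer.Tactic.RingSolver using (solve-∀)
open import Data.Nat using (suc)
open import Data.Product using (_×_; _,_)
open import Function using (_∘_)
open import Relation.Binary.PropositionalEquality as ≡ using (_≡_)
open import Relation.Nullary using (¬_)

module SomosIdentities {c ℓ : Level} (R : CommutativeRing c ℓ) where
  open CommutativeRing R
  open import Algebra.Properties.Ring ring using (+-cancelʳ)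
  open import Algebra.Solver.Ring.NaturalCoefficients.Default commutativeSemiring
    using (solve; Polynomial; _:+_; _:*_; _:=_)

  product₅ : Carrier → Carrier → Carrier → Carrier → Carrier → Carrier
  product₅ s₀ s₁ s₂ s₃ s₄ = s₀ * s₁ * s₂ * s₃ * s₄

  invariantNumerator : (a b s₀ s₁ s₂ s₃ s₄ : Carrier) → Carrier
  invariantNumerator a b s₀ s₁ s₂ s₃ s₄ =
    a * s₀ * s₂ * s₂ * s₃ * s₃ + a * s₁ * s₁ * s₂ * s₂ * s₄ + b * s₁ * s₂ * s₂ * s₂ * s₃
      + s₀ * s₁ * s₁ * s₄ * s₄ + s₀ * s₀ * s₃ * s₃ * s₄

  invariantNumeratorᴾ : ∀ {n} (a b s₀ s₁ s₂ s₃ s₄ : Polynomial n) → Polynomial n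
  invariantNumeratorᴾ a b s₀ s₁ s₂ s₃ s₄ =
    a :* s₀ :* s₂ :* s₂ :* s₃ :* s₃ :+ a :* s₁ :* s₁ :* s₂ :* s₂ :* s₄ :+ b :* s₁ :* s₂ :* s₂ :* s₂ :* s₃
      :+ s₀ :* s₁ :* s₁ :* s₄ :* s₄ :+ s₀ :* s₀ :* s₃ :* s₃ :* s₄

  somos4Coefficient : (a b J : Carrier) → Carrier
  somos4Coefficient a b J = a * (b * b + b * b + a * b * J + a * a * a)

  somos4Coefficient-cong : ∀ {a b J J′} → J ≈ J′ → somos4Coefficient a b J ≈ somos4Coefficient a b J′
  somos4Coefficient-cong J≈J′ = *-cong refl (+-cong (+-cong refl (*-cong refl J≈J′)) refl)

  -- Certificates l + Σ cᵢ rᵢ ≈ r + Σ cᵢ lᵢ (with hypotheses lᵢ ≈ rᵢ) avoid subtraction so that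
  -- the natural-coefficient semiring solver can check them.
  by-certificate : ∀ {l r s s′} → l + s ≈ r + s′ → s′ ≈ s → l ≈ r
  by-certificate {l} {r} {s} certificate s′≈s =
    +-cancelʳ s l r (trans certificate (+-cong refl s′≈s))

  invariant-cleared : ∀ {a b s₀ s₁ s₂ s₃ s₄ h₁ h₀ g₁ g₀ k} →
    h₁ * (s₂ * s₁) ≈ s₃ * s₀ → h₀ * (s₃ * s₂) ≈ s₄ * s₁ →
    g₁ * (s₃ * s₀) ≈ s₂ * s₁ → g₀ * (s₄ * s₁) ≈ s₃ * s₂ →
    k * (s₃ * s₀ * (s₄ * s₁)) ≈ s₂ * s₁ * (s₃ * s₂) →
    product₅ s₀ s₁ s₂ s₃ s₄ * (h₁ + h₀ + a * (g₁ + g₀) + b * k) ≈ invariantNumerator a b s₀ s₁ s₂ s₃ s₄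
  invariant-cleared {a} {b} {s₀} {s₁} {s₂} {s₃} {s₄} {h₁} {h₀} {g₁} {g₀} {k} e₁ e₀ f₁ f₀ eₖ =
    by-certificate
      (solve 12 (λ a b s₀ s₁ s₂ s₃ s₄ h₁ h₀ g₁ g₀ k →
          s₀ :* s₁ :* s₂ :* s₃ :* s₄ :* (h₁ :+ h₀ :+ a :* (g₁ :+ g₀) :+ b :* k)
            :+ (s₀ :* s₃ :* s₄ :* (s₃ :* s₀) :+ s₀ :* s₁ :* s₄ :* (s₄ :* s₁)
                :+ a :* s₁ :* s₂ :* s₄ :* (s₂ :* s₁) :+ a :* s₀ :* s₂ :* s₃ :* (s₃ :* s₂)
                :+ b :* s₂ :* (s₂ :* s₁ :* (s₃ :* s₂)))
          := invariantNumeratorᴾ a b s₀ s₁ s₂ s₃ s₄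
            :+ (s₀ :* s₃ :* s₄ :* (h₁ :* (s₂ :* s₁)) :+ s₀ :* s₁ :* s₄ :* (h₀ :* (s₃ :* s₂))
                :+ a :* s₁ :* s₂ :* s₄ :* (g₁ :* (s₃ :* s₀)) :+ a :* s₀ :* s₂ :* s₃ :* (g₀ :* (s₄ :* s₁))
                :+ b :* s₂ :* (k :* (s₃ :* s₀ :* (s₄ :* s₁)))))
        refl a b s₀ s₁ s₂ s₃ s₄ h₁ h₀ g₁ g₀ k)
      (+-cong (+-cong (+-cong (+-cong (*-cong refl e₁) (*-cong refl e₀)) (*-cong refl f₁)) (*-cong refl f₀))
              (*-cong refl eₖ))

  invariantNumerator-shift : ∀ {a b s₀ s₁ s₂ s₃ s₄ s₅} →
    s₅ * s₀ ≈ a * s₄ * s₁ + b * s₃ * s₂ →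
    invariantNumerator a b s₀ s₁ s₂ s₃ s₄ * product₅ s₁ s₂ s₃ s₄ s₅
      ≈ invariantNumerator a b s₁ s₂ s₃ s₄ s₅ * product₅ s₀ s₁ s₂ s₃ s₄
  invariantNumerator-shift {a} {b} {s₀} {s₁} {s₂} {s₃} {s₄} {s₅} somos5 =
    by-certificate
      (solve 8 (λ a b s₀ s₁ s₂ s₃ s₄ s₅ →
          let c₁ = s₁ :* s₁ :* s₂ :* s₂ :* s₂ :* s₃ :* s₄ :* s₅
              c₂ = s₀ :* s₁ :* s₂ :* s₃ :* s₃ :* s₃ :* s₄ :* s₄
          in invariantNumeratorᴾ a b s₀ s₁ s₂ s₃ s₄ :* (s₁ :* s₂ :* s₃ :* s₄ :* s₅)
               :+ (c₁ :* (s₅ :* s₀) :+ c₂ :* (a :* s₄ :* s₁ :+ b :* s₃ :* s₂))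
             := invariantNumeratorᴾ a b s₁ s₂ s₃ s₄ s₅ :* (s₀ :* s₁ :* s₂ :* s₃ :* s₄)
               :+ (c₁ :* (a :* s₄ :* s₁ :+ b :* s₃ :* s₂) :+ c₂ :* (s₅ :* s₀)))
        refl a b s₀ s₁ s₂ s₃ s₄ s₅)
      (+-cong (*-cong refl (sym somos5)) (*-cong refl somos5))

  somos4-skip-cleared : ∀ {a b J t₋₄ t₋₃ t₋₂ t₋₁ t₀ t₁ t₂ t₃ t₄} →
    product₅ t₋₂ t₋₁ t₀ t₁ t₂ * J ≈ invariantNumerator a b t₋₂ t₋₁ t₀ t₁ t₂ →
    t₄ * t₋₁ ≈ a * t₃ * t₀ + b * t₂ * t₁ →
    t₃ * t₋₂ ≈ a * t₂ * t₋₁ + b * t₁ * t₀ →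
    t₂ * t₋₃ ≈ a * t₁ * t₋₂ + b * t₀ * t₋₁ →
    t₁ * t₋₄ ≈ a * t₀ * t₋₃ + b * t₋₁ * t₋₂ →
    product₅ t₋₂ t₋₁ t₀ t₁ t₂ * (t₄ * t₋₄)
      ≈ product₅ t₋₂ t₋₁ t₀ t₁ t₂ * (b * b * t₂ * t₋₂ + somos4Coefficient a b J * (t₀ * t₀))
  somos4-skip-cleared {a} {b} {J} {t₋₄} {t₋₃} {t₋₂} {t₋₁} {t₀} {t₁} {t₂} {t₃} {t₄} invariant e₁ e₀ e₋₁ e₋₂ =
    by-certificate
      (solve 12 (λ a b J t₋₄ t₋₃ t₋₂ t₋₁ t₀ t₁ t₂ t₃ t₄ →
          let D  = t₋₂ :* t₋₁ :* t₀ :* t₁ :* t₂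
              cᴶ = a :* a :* b :* t₀ :* t₀
              c₁ = t₀ :* t₁ :* t₂ :* t₋₂ :* t₋₄
              c₀ = a :* t₀ :* t₀ :* t₁ :* t₂ :* t₋₄
              c₋₁ = a :* b :* t₀ :* t₀ :* t₁ :* t₂ :* t₋₂ :+ a :* a :* b :* t₀ :* t₀ :* t₀ :* t₀ :* t₁
                      :+ a :* a :* a :* t₀ :* t₀ :* t₀ :* t₂ :* t₋₁
              c₋₂ = a :* b :* t₀ :* t₀ :* t₀ :* t₁ :* t₂ :+ a :* a :* t₀ :* t₀ :* t₂ :* t₂ :* t₋₁
                      :+ b :* t₀ :* t₁ :* t₂ :* t₂ :* t₋₂
          in D :* (t₄ :* t₋₄)
               :+ (cᴶ :* (D :* J) :+ c₁ :* (a :* t₃ :* t₀ :+ b :* t₂ :* t₁) :+ c₀ :* (a :* t₂ :* t₋₁ :+ b :* t₁ :* t₀)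
                   :+ c₋₁ :* (a :* t₁ :* t₋₂ :+ b :* t₀ :* t₋₁) :+ c₋₂ :* (a :* t₀ :* t₋₃ :+ b :* t₋₁ :* t₋₂))
             := D :* (b :* b :* t₂ :* t₋₂ :+ a :* (b :* b :+ b :* b :+ a :* b :* J :+ a :* a :* a) :* (t₀ :* t₀))
               :+ (cᴶ :* invariantNumeratorᴾ a b t₋₂ t₋₁ t₀ t₁ t₂ :+ c₁ :* (t₄ :* t₋₁) :+ c₀ :* (t₃ :* t₋₂)
                   :+ c₋₁ :* (t₂ :* t₋₃) :+ c₋₂ :* (t₁ :* t₋₄)))
        refl a b J t₋₄ t₋₃ t₋₂ t₋₁ t₀ t₁ t₂ t₃ t₄)
      (+-cong (+-cong (+-cong (+-cong (*-cong refl (sym invariant)) (*-cong refl e₁)) (*-cong refl e₀))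
                      (*-cong refl e₋₁))
              (*-cong refl e₋₂))

module FieldProperties {c ℓ : Level} (F : Field c ℓ) where
  open Field F
  open SomosIdentities commutativeRing using (product₅)
  open import Relation.Binary.Reasoning.Setoid setoid

  inverseˡ : ∀ x → ¬ (x ≈ 0#) → inv x * x ≈ 1#
  inverseˡ x x≉0 = trans (*-comm (inv x) x) (inverseʳ x x≉0)

  *-cancelˡ-≉0 : ∀ {x y z} → ¬ (x ≈ 0#) → x * y ≈ x * z → y ≈ z
  *-cancelˡ-≉0 {x} {y} {z} x≉0 xy≈xz = begin
    y                ≈⟨ *-identityˡ y ⟨
    1# * y           ≈⟨ *-cong (inverseˡ x x≉0) refl ⟨
    inv x * x * y    ≈⟨ *-assoc (inv x) x y ⟩
    inv x * (x * y)  ≈⟨ *-cong refl xy≈xz ⟩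
    inv x * (x * z)  ≈⟨ *-assoc (inv x) x z ⟨
    inv x * x * z    ≈⟨ *-cong (inverseˡ x x≉0) refl ⟩
    1# * z           ≈⟨ *-identityˡ z ⟩
    z                ∎

  *-≉0 : ∀ {x y} → ¬ (x ≈ 0#) → ¬ (y ≈ 0#) → ¬ (x * y ≈ 0#)
  *-≉0 {x} {y} x≉0 y≉0 xy≈0 = y≉0 (*-cancelˡ-≉0 x≉0 (trans xy≈0 (sym (zeroʳ x))))

  product₅-≉0 : ∀ {s₀ s₁ s₂ s₃ s₄} →
    ¬ (s₀ ≈ 0#) → ¬ (s₁ ≈ 0#) → ¬ (s₂ ≈ 0#) → ¬ (s₃ ≈ 0#) → ¬ (s₄ ≈ 0#) →
    ¬ (product₅ s₀ s₁ s₂ s₃ s₄ ≈ 0#)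
  product₅-≉0 s₀≉0 s₁≉0 s₂≉0 s₃≉0 s₄≉0 = *-≉0 (*-≉0 (*-≉0 (*-≉0 s₀≉0 s₁≉0) s₂≉0) s₃≉0) s₄≉0

  ratio-cleared : ∀ {a b} → ¬ (b ≈ 0#) → a * inv b * b ≈ a
  ratio-cleared {a} {b} b≉0 = begin
    a * inv b * b    ≈⟨ *-assoc a (inv b) b ⟩
    a * (inv b * b)  ≈⟨ *-cong refl (inverseˡ b b≉0) ⟩
    a * 1#           ≈⟨ *-identityʳ a ⟩
    a                ∎

  inv-ratio : ∀ {u a b} → u * b ≈ a → ¬ (a ≈ 0#) → inv u * a ≈ b
  inv-ratio {u} {a} {b} ub≈a a≉0 = begin
    inv u * a        ≈⟨ *-cong refl ub≈a ⟨
    inv u * (u * b)  ≈⟨ *-assoc (inv u) u b ⟨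
    inv u * u * b    ≈⟨ *-cong (inverseˡ u u≉0) refl ⟩
    1# * b           ≈⟨ *-identityˡ b ⟩
    b                ∎
    where
    u≉0 : ¬ (u ≈ 0#)
    u≉0 u≈0 = a≉0 (trans (sym ub≈a) (trans (*-cong u≈0 refl) (zeroˡ b)))

  cross-multiply : ∀ {x y u v p q} → x * u ≈ p → y * v ≈ q → p * y ≈ q * x →
    ¬ (x ≈ 0#) → ¬ (y ≈ 0#) → u ≈ v
  cross-multiply {x} {y} {u} {v} {p} {q} xu≈p yv≈q py≈qx x≉0 y≉0 = *-cancelˡ-≉0 (*-≉0 x≉0 y≉0) (begin
    x * y * u    ≈⟨ *-cong (*-comm x y) refl ⟩
    y * x * u    ≈⟨ *-assoc y x u ⟩
    y * (x * u)  ≈⟨ *-cong refl xu≈p ⟩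
    y * p        ≈⟨ *-comm y p ⟩
    p * y        ≈⟨ py≈qx ⟩
    q * x        ≈⟨ *-comm q x ⟩
    x * q        ≈⟨ *-cong refl yv≈q ⟨
    x * (y * v)  ≈⟨ *-assoc x y v ⟨
    x * y * v    ∎)

shift : ∀ {a} {A : Set a} → (ℤ → A) → ℤ → ℤ → A
shift τ m i = τ (m ℤ.+ i)

module SomosSequence {c ℓ : Level} (F : Field c ℓ) (α β : Field.Carrier F) where
  open Field F
  open FieldProperties F
  open SomosIdentities commutativeRing
  open import Relation.Binary.Reasoning.Setoid setoid

  NonVanishing : (ℤ → Carrier) → Set ℓ
  NonVanishing τ = ∀ n → ¬ (τ n ≈ 0#)

  NonVanishing-shift : ∀ {τ} → NonVanishing τ → ∀ m → NonVanishing (shift τ m)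
  NonVanishing-shift τ≉0 m n = τ≉0 (m ℤ.+ n)

  module Shift (τ : ℤ → Carrier) where

    Somos5-shift : Somos5 F α β τ → ∀ m → Somos5 F α β (shift τ m)
    Somos5-shift somos5 m n
      rewrite ≡.sym (ℤ.+-assoc m n (+ 3)) | ≡.sym (ℤ.+-assoc m n (ℤ.- + 2))
            | ≡.sym (ℤ.+-assoc m n (+ 2)) | ≡.sym (ℤ.+-assoc m n (ℤ.- + 1))
            | ≡.sym (ℤ.+-assoc m n (+ 1)) = somos5 (m ℤ.+ n)

    hSeq-shift : ∀ m n → hSeq F (shift τ m) n ≡ hSeq F τ (m ℤ.+ n)
    hSeq-shift m n
      rewrite ℤ.+-assoc m n (+ 2) | ℤ.+-assoc m n (ℤ.- + 1) | ℤ.+-assoc m n (+ 1) = ≡.refl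

    Jat-shift : ∀ m n → Jat F α β (shift τ m) n ≡ Jat F α β τ (m ℤ.+ n)
    Jat-shift m n
      rewrite hSeq-shift m (n ℤ.- + 1) | hSeq-shift m n | ℤ.+-assoc m n (ℤ.- + 1) = ≡.refl

  -- At index 0 all offsets are closed integers, so the needed instances of Somos5 and hSeq
  -- compute to expressions in τ (+ i); other indices are reached through Shift.
  module Centred {τ : ℤ → Carrier} (τ≉0 : NonVanishing τ) where

    hSeq-cleared : ∀ n → hSeq F τ n * (τ (n ℤ.+ + 1) * τ n) ≈ τ (n ℤ.+ + 2) * τ (n ℤ.- + 1)
    hSeq-cleared n = ratio-cleared (*-≉0 (τ≉0 _) (τ≉0 _))

    window≉0 : ¬ (product₅ (τ (ℤ.- + 2)) (τ (ℤ.- + 1)) (τ (+ 0)) (τ (+ 1)) (τ (+ 2)) ≈ 0#)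
    window≉0 = product₅-≉0 (τ≉0 _) (τ≉0 _) (τ≉0 _) (τ≉0 _) (τ≉0 _)

    Jat₀-cleared : product₅ (τ (ℤ.- + 2)) (τ (ℤ.- + 1)) (τ (+ 0)) (τ (+ 1)) (τ (+ 2)) * Jat F α β τ (+ 0)
                     ≈ invariantNumerator α β (τ (ℤ.- + 2)) (τ (ℤ.- + 1)) (τ (+ 0)) (τ (+ 1)) (τ (+ 2))
    Jat₀-cleared = invariant-cleared h₋₁-cleared h₀-cleared
      (inv-ratio h₋₁-cleared (*-≉0 (τ≉0 _) (τ≉0 _)))
      (inv-ratio h₀-cleared (*-≉0 (τ≉0 _) (τ≉0 _)))
      (inv-ratio (trans (interchange _ _ _ _) (*-cong h₋₁-cleared h₀-cleared))
                 (*-≉0 (*-≉0 (τ≉0 _) (τ≉0 _)) (*-≉0 (τ≉0 _) (τ≉0 _))))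
      where
      open import Algebra.Properties.CommutativeSemigroup *-commutativeSemigroup using (interchange)
      h₋₁-cleared : hSeq F τ (ℤ.- + 1) * (τ (+ 0) * τ (ℤ.- + 1)) ≈ τ (+ 1) * τ (ℤ.- + 2)
      h₋₁-cleared = hSeq-cleared (ℤ.- + 1)
      h₀-cleared : hSeq F τ (+ 0) * (τ (+ 1) * τ (+ 0)) ≈ τ (+ 2) * τ (ℤ.- + 1)
      h₀-cleared = hSeq-cleared (+ 0)

  module _ {τ : ℤ → Carrier} (τ≉0 : NonVanishing τ) (somos5 : Somos5 F α β τ) where
    open Shift τ

    Jat₀≈Jat₁ : Jat F α β τ (+ 0) ≈ Jat F α β τ (+ 1)
    Jat₀≈Jat₁ = trans
      (cross-multiply (Centred.Jat₀-cleared τ≉0) (Centred.Jat₀-cleared τ₁≉0)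
        (invariantNumerator-shift (somos5 (+ 0))) (Centred.window≉0 τ≉0) (Centred.window≉0 τ₁≉0))
      (reflexive (Jat-shift (+ 1) (+ 0)))
      where
      τ₁≉0 : NonVanishing (shift τ (+ 1))
      τ₁≉0 = NonVanishing-shift τ≉0 (+ 1)

    somos4-skip₀ : τ (+ 4) * τ (ℤ.- + 4)
      ≈ β * β * τ (+ 2) * τ (ℤ.- + 2) + somos4Coefficient α β (Jat F α β τ (+ 0)) * (τ (+ 0) * τ (+ 0))
    somos4-skip₀ = *-cancelˡ-≉0 (Centred.window≉0 τ≉0)
      (somos4-skip-cleared (Centred.Jat₀-cleared τ≉0)
        (somos5 (+ 1)) (somos5 (+ 0)) (somos5 (ℤ.- + 1)) (somos5 (ℤ.- + 2)))

  module _ {τ : ℤ → Carrier} (τ≉0 : NonVanishing τ) (somos5 : Somos5 F α β τ) where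
    open Shift τ

    Jat-step : ∀ n → Jat F α β τ n ≈ Jat F α β τ (n ℤ.+ + 1)
    Jat-step n = begin
      Jat F α β τ n                ≡⟨ ≡.cong (Jat F α β τ) (ℤ.+-identityʳ n) ⟨
      Jat F α β τ (n ℤ.+ + 0)      ≡⟨ Jat-shift n (+ 0) ⟨
      Jat F α β (shift τ n) (+ 0)  ≈⟨ Jat₀≈Jat₁ (NonVanishing-shift τ≉0 n) (Somos5-shift somos5 n) ⟩
      Jat F α β (shift τ n) (+ 1)  ≡⟨ Jat-shift n (+ 1) ⟩
      Jat F α β τ (n ℤ.+ + 1)      ∎

    Jat-constant : ∀ n → Jat F α β τ n ≈ Jat F α β τ (+ 0)
    Jat-constant (+ 0)         = refl
    Jat-constant (+ suc k)     = begin
      Jat F α β τ (+ suc k)        ≡⟨ ≡.cong (Jat F α β τ) (ℤ.+-comm (+ k) (+ 1)) ⟨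
      Jat F α β τ (+ k ℤ.+ + 1)    ≈⟨ Jat-step (+ k) ⟨
      Jat F α β τ (+ k)            ≈⟨ Jat-constant (+ k) ⟩
      Jat F α β τ (+ 0)            ∎
    Jat-constant -[1+ 0 ]      = Jat-step -[1+ 0 ]
    Jat-constant -[1+ suc k ]  = trans (Jat-step -[1+ suc k ]) (Jat-constant -[1+ k ])

    somos4-skip : ∀ k m → τ (m ℤ.+ + 4) * τ (m ℤ.- + 4)
      ≈ β * β * τ (m ℤ.+ + 2) * τ (m ℤ.- + 2) + somos4Coefficient α β (Jat F α β τ k) * (τ m * τ m)
    somos4-skip k m = trans
      (somos4-skip₀ (NonVanishing-shift τ≉0 m) (Somos5-shift somos5 m))
      (+-cong refl (*-cong (somos4Coefficient-cong Jat-centre)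
                           (reflexive (≡.cong (λ i → τ i * τ i) (ℤ.+-identityʳ m)))))
      where
      Jat-centre : Jat F α β (shift τ m) (+ 0) ≈ Jat F α β τ k
      Jat-centre = begin
        Jat F α β (shift τ m) (+ 0)  ≡⟨ Jat-shift m (+ 0) ⟩
        Jat F α β τ (m ℤ.+ + 0)      ≡⟨ ≡.cong (Jat F α β τ) (ℤ.+-identityʳ m) ⟩
        Jat F α β τ m                ≈⟨ Jat-constant m ⟩
        Jat F α β τ (+ 0)            ≈⟨ Jat-constant k ⟨
        Jat F α β τ k                ∎

  Somos4-everyOther : ∀ {a b} {τ : ℤ → Carrier} →
    (∀ m → τ (m ℤ.+ + 4) * τ (m ℤ.- + 4) ≈ a * τ (m ℤ.+ + 2) * τ (m ℤ.- + 2) + b * (τ m * τ m)) →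
    (ι : ℤ → ℤ) → (∀ n d → ι (n ℤ.+ d) ≡ ι n ℤ.+ + 2 ℤ.* d) → Somos4 F a b (τ ∘ ι)
  Somos4-everyOther skip ι ι-step n
    rewrite ι-step n (+ 2) | ι-step n (ℤ.- + 2) | ι-step n (+ 1) | ι-step n (ℤ.- + 1) = skip (ι n)

proposition2p8 : ∀ {c ℓ : Level} (F : Field c ℓ) → CharZero F →
    let open Field F in
    (α β : Carrier) (τ : ℤ → Carrier) →
    (∀ n → ¬ (τ n ≈ 0#)) →
    Somos5 F α β τ →
    ∀ (k : ℤ) →
    Somos4 F (β * β) (α * ((β * β + β * β) + α * β * Jat F α β τ k + α * α * α)) (evenSub τ)
    × Somos4 F (β * β) (α * ((β * β + β * β) + α * β * Jat F α β τ k + α * α * α)) (oddSub τ)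
proposition2p8 F _ α β τ τ≉0 somos5 k =
    Somos4-everyOther (somos4-skip τ≉0 somos5 k) (λ n → + 2 ℤ.* n) (λ n d → ℤ.*-distribˡ-+ (+ 2) n d)
  , Somos4-everyOther (somos4-skip τ≉0 somos5 k) (λ n → + 2 ℤ.* n ℤ.+ + 1) odd-step
  where
  open SomosSequence F α β
  odd-step : ∀ n d → + 2 ℤ.* (n ℤ.+ d) ℤ.+ + 1 ≡ + 2 ℤ.* n ℤ.+ + 1 ℤ.+ + 2 ℤ.* d
  odd-step = solve-∀
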